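{- Let $p\equiv 7\pmod 8$ be a prime and let $\theta=1+\sqrt2$, where $\sqrt2$ is a square root of $2$ in $\mathbb{Z}_p$. If $\theta$ generates $\mathbb{Z}_p^*/\{1,-1\}$, then there exists an APS$(p,1,\theta-1)$.
   Context: $\mathbb{Z}_p^*$ is the multiplicative group of nonzero residues mod $p$. APS$(n,\alpha,\beta)$ ($n\equiv3\pmod4$, $\alpha,\beta$ nonzero in $\mathbb{Z}_n$): a set $\mathcal S$ of $(n-3)/4$ unordered pairs $\{x,y\}$ from $\mathbb{Z}_n$ with $\bigcup_{\{x,y\}\in\mathcal S}\pm\{x,y\}=\mathbb{Z}_n\setminus\{0,\pm\alpha\}$ and $\bigcup_{\{x,y\}\in\mathcal S}\pm\{x-y,x+y\}=\mathbb{Z}_n\setminus\{0,\pm\beta\}$. -}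

module Defs where

open import Data.Nat using (ℕ; zero; suc; _+_; _*_; _∸_; _^_; _<_; _/_; _%_; NonZero)
open import Data.Product using (_×_; _,_; ∃)
open import Data.Sum using (_⊎_)
open import Data.List using (List; length)
open import Data.List.Relation.Unary.All using (All)
open import Data.List.Relation.Unary.Any using (Any)
open import Relation.Nullary using (¬_)
open import Relation.Binary.PropositionalEquality using (_≡_)
open import Function.Bundles using (_⇔_)

-- Elements of ℤ_n are represented by natural numbers; the canonical
-- representative of x is x % n.  Arithmetic in ℤ_n:
negₙ : (n : ℕ) → .{{NonZero n}} → ℕ → ℕ
negₙ n x = (n ∸ (x % n)) % n

addₙ : (n : ℕ) → .{{NonZero n}} → ℕ → ℕ → ℕ
addₙ n x y = (x + y) % n

subₙ : (n : ℕ) → .{{NonZero n}} → ℕ → ℕ → ℕ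
subₙ n x y = (x + negₙ n y) % n

-- z ∈ ±{a, b}  in ℤ_n  (z is taken to be a canonical representative, z < n)
_∈±[_,_]mod_ : ℕ → ℕ → ℕ → (n : ℕ) → .{{NonZero n}} → Set
z ∈±[ a , b ]mod n =
  (z ≡ a % n ⊎ z ≡ negₙ n a) ⊎ (z ≡ b % n ⊎ z ≡ negₙ n b)

-- APS(n, α, β): a set S of (n-3)/4 pairs {x,y} from ℤ_n with
--   ⋃ ±{x,y}       = ℤ_n ∖ {0, ±α}
--   ⋃ ±{x-y, x+y}  = ℤ_n ∖ {0, ±β}.
-- Pairs are listed as ordered pairs of canonical representatives; both
-- conditions are symmetric in x,y, so this models unordered pairs.
record APS (n : ℕ) .{{_ : NonZero n}} (α β : ℕ) : Set where
  field
    n≡3mod4   : n % 4 ≡ 3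
    α≢0       : ¬ (α % n ≡ 0)
    β≢0       : ¬ (β % n ≡ 0)
    pairs     : List (ℕ × ℕ)
    inRange   : All (λ xy → (Data.Product.proj₁ xy < n) × (Data.Product.proj₂ xy < n)) pairs
    size      : length pairs ≡ (n ∸ 3) / 4
    cover₁    : ∀ z → z < n →
      (Any (λ xy → z ∈±[ Data.Product.proj₁ xy , Data.Product.proj₂ xy ]mod n) pairs
        ⇔ (¬ (z ≡ 0) × ¬ (z ≡ α % n) × ¬ (z ≡ negₙ n α)))
    cover₂    : ∀ z → z < n →
      (Any (λ xy → z ∈±[ subₙ n (Data.Product.proj₁ xy) (Data.Product.proj₂ xy)
                       , addₙ n (Data.Product.proj₁ xy) (Data.Product.proj₂ xy) ]mod n) pairs
        ⇔ (¬ (z ≡ 0) × ¬ (z ≡ β % n) × ¬ (z ≡ negₙ n β)))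

GeneratesModSign : (p : ℕ) → .{{NonZero p}} → ℕ → Set
GeneratesModSign p g =
  ∀ x → ¬ (x % p ≡ 0) → ∃ λ k → ((g ^ k) % p ≡ x % p) ⊎ ((g ^ k) % p ≡ negₙ p x)

-- Put θ = 1 + s and m = (p - 1) / 2.  The m classes ±1, …, ±m exhaust ℤ_p^* / {±1}, so by
-- pigeonhole θ has order exactly m there: θ, θ², …, θ^(m-1) run through all classes ±w with
-- w ≠ 0, ±1.  Pairing consecutive powers {θ^(2i+1), θ^(2i+2)} gives the first covering.  For a
-- pair {x, θx} we have x - θx = -s x and x + θx = (2 + s) x = s θx since s² = 2, so the
-- differences and sums are the pairs multiplied by the unit s and cover all but 0 and ±s = ±(θ - 1).
module Submission where

import Algebra.Properties.CommutativeSemigroup as CommutativeSemigroupProperties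
open import Data.Empty using (⊥-elim)
open import Data.Fin as Fin using (Fin; toℕ; fromℕ<)
open import Data.Fin.Properties using (pigeonhole; toℕ-fromℕ<; toℕ<n; toℕ-injective)
open import Data.List using (List; applyUpTo)
open import Data.List.Properties using (length-applyUpTo)
open import Data.List.Relation.Unary.Any using (Any)
import Data.List.Relation.Unary.Any.Properties as Any
import Data.List.Relation.Unary.All.Properties as All
open import Data.Nat
  using (ℕ; zero; suc; _+_; _*_; _∸_; _^_; _%_; _/_; _<_; _≤_; _<?_; z≤n; s≤s; z<s; s<s;
         NonZero; >-nonZero; >-nonZero⁻¹)
open import Data.Nat.DivMod
open import Data.Nat.Primality using (Prime)
open import Data.Nat.Properties
open import Data.Nat.Tactic.RingSolver using (solve-∀)
open import Data.Product using (_×_; _,_; ∃; ∃₂; proj₁; proj₂)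
open import Data.Product.Function.NonDependent.Propositional using (_×-⇔_)
open import Data.Sum using (_⊎_; inj₁; inj₂; [_,_]′)
open import Data.Sum.Function.Propositional using (_⊎-⇔_)
open import Function using (_∘_)
open import Function.Bundles using (_⇔_; mk⇔; Equivalence)
open import Function.Properties.Equivalence using () renaming (trans to ⇔-trans; sym to ⇔-sym)
open import Function.Related.TypeIsomorphisms using (¬-cong-⇔)
open import Level using (0ℓ)
open import Relation.Binary.Bundles using (Setoid)
import Relation.Binary.Construct.On as On
open import Relation.Binary.PropositionalEquality
import Relation.Binary.Reasoning.Setoid as SetoidReasoning
open import Relation.Nullary using (¬_; yes; no)

open import Defs

open Equivalence using (to; from)
open CommutativeSemigroupProperties +-commutativeSemigroup using () renaming (xy∙z≈xz∙y to +-right-comm)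
open CommutativeSemigroupProperties *-commutativeSemigroup using () renaming (interchange to *-interchange)

module Congruence (n : ℕ) .{{_ : NonZero n}} where

  infix 4 _≈_ _≈±_

  _≈_ : ℕ → ℕ → Set
  a ≈ b = a % n ≡ b % n

  ≈-setoid : Setoid 0ℓ 0ℓ
  ≈-setoid = On.setoid (setoid ℕ) (_% n)

  open Setoid ≈-setoid public
    using () renaming (refl to ≈-refl; sym to ≈-sym; trans to ≈-trans; reflexive to ≡⇒≈)
  module ≈-Reasoning = SetoidReasoning ≈-setoid
  open ≈-Reasoning

  0%n≡0 : 0 % n ≡ 0
  0%n≡0 = m<n⇒m%n≡m (>-nonZero⁻¹ n)

  %-≈ : ∀ a → a % n ≈ a
  %-≈ a = m%n%n≡m%n a n

  n≈0 : n ≈ 0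
  n≈0 = trans (n%n≡0 n) (sym 0%n≡0)

  +-cong : ∀ {a a′ b b′} → a ≈ a′ → b ≈ b′ → a + b ≈ a′ + b′
  +-cong {a} {a′} {b} {b′} a≈a′ b≈b′ =
    trans (%-distribˡ-+ a b n)
      (trans (cong₂ (λ x y → (x + y) % n) a≈a′ b≈b′) (sym (%-distribˡ-+ a′ b′ n)))

  *-cong : ∀ {a a′ b b′} → a ≈ a′ → b ≈ b′ → a * b ≈ a′ * b′
  *-cong {a} {a′} {b} {b′} a≈a′ b≈b′ =
    trans (%-distribˡ-* a b n)
      (trans (cong₂ (λ x y → (x * y) % n) a≈a′ b≈b′) (sym (%-distribˡ-* a′ b′ n)))

  +-inverseˡ : ∀ a → negₙ n a + a ≈ 0
  +-inverseˡ a = begin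
    negₙ n a + a         ≈⟨ +-cong (%-≈ (n ∸ a % n)) (≈-sym (%-≈ a)) ⟩
    (n ∸ a % n) + a % n  ≡⟨ m∸n+n≡m (m%n≤n a n) ⟩
    n                    ≈⟨ n≈0 ⟩
    0                    ∎

  +-inverseʳ : ∀ a → a + negₙ n a ≈ 0
  +-inverseʳ a = ≈-trans (≡⇒≈ (+-comm a (negₙ n a))) (+-inverseˡ a)

  +-cancelʳ : ∀ {a b} c → a + c ≈ b + c → a ≈ b
  +-cancelʳ {a} {b} c a+c≈b+c = begin
    a                   ≡⟨ +-identityʳ a ⟨
    a + 0               ≈⟨ +-cong (≈-refl {a}) (+-inverseʳ c) ⟨
    a + (c + negₙ n c)  ≡⟨ +-assoc a c _ ⟨
    a + c + negₙ n c    ≈⟨ +-cong a+c≈b+c ≈-refl ⟩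
    b + c + negₙ n c    ≡⟨ +-assoc b c _ ⟩
    b + (c + negₙ n c)  ≈⟨ +-cong (≈-refl {b}) (+-inverseʳ c) ⟩
    b + 0               ≡⟨ +-identityʳ b ⟩
    b                   ∎

  subₙ-+ : ∀ a b → subₙ n a b + b ≈ a
  subₙ-+ a b = begin
    subₙ n a b + b      ≈⟨ +-cong (%-≈ (a + negₙ n b)) (≈-refl {b}) ⟩
    a + negₙ n b + b    ≡⟨ +-assoc a _ b ⟩
    a + (negₙ n b + b)  ≈⟨ +-cong (≈-refl {a}) (+-inverseˡ b) ⟩
    a + 0               ≡⟨ +-identityʳ a ⟩
    a                   ∎

  *-inverse-cancelˡ : ∀ {u v} → u * v ≈ 1 → ∀ a → u * (v * a) ≈ a
  *-inverse-cancelˡ {u} {v} uv≈1 a = begin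
    u * (v * a)  ≡⟨ *-assoc u v a ⟨
    u * v * a    ≈⟨ *-cong uv≈1 (≈-refl {a}) ⟩
    1 * a        ≡⟨ *-identityˡ a ⟩
    a            ∎

  *-inverse-cancelʳ : ∀ {u v} → u * v ≈ 1 → ∀ a → v * (u * a) ≈ a
  *-inverse-cancelʳ {u} {v} uv≈1 = *-inverse-cancelˡ {v} {u} (≈-trans (≡⇒≈ (*-comm v u)) uv≈1)

  *-cancelˡ : ∀ {u v a b} → u * v ≈ 1 → u * a ≈ u * b → a ≈ b
  *-cancelˡ {u} {v} {a} {b} uv≈1 ua≈ub = begin
    a            ≈⟨ *-inverse-cancelʳ {u} {v} uv≈1 a ⟨
    v * (u * a)  ≈⟨ *-cong (≈-refl {v}) ua≈ub ⟩
    v * (u * b)  ≈⟨ *-inverse-cancelʳ {u} {v} uv≈1 b ⟩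
    b            ∎

  ^-inverse : ∀ {u v} → u * v ≈ 1 → ∀ k → u ^ k * v ^ k ≈ 1
  ^-inverse uv≈1 zero = refl
  ^-inverse {u} {v} uv≈1 (suc k) = begin
    u * u ^ k * (v * v ^ k)    ≡⟨ *-interchange u (u ^ k) v (v ^ k) ⟩
    u * v * (u ^ k * v ^ k)    ≈⟨ *-cong uv≈1 (^-inverse uv≈1 k) ⟩
    1                          ∎

  ≈⇒≡ : ∀ {a b} → a < n → b < n → a ≈ b → a ≡ b
  ≈⇒≡ a<n b<n a≈b = trans (sym (m<n⇒m%n≡m a<n)) (trans a≈b (m<n⇒m%n≡m b<n))

  ≈0⇒≡0 : ∀ {a} → a < n → a ≈ 0 → a ≡ 0
  ≈0⇒≡0 a<n = ≈⇒≡ a<n (>-nonZero⁻¹ n)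

  1≉0 : 1 < n → ¬ 1 ≈ 0
  1≉0 1<n 1≈0 with ≈0⇒≡0 1<n 1≈0
  ... | ()

  unit-nonzero : ∀ {u v} → ¬ 1 ≈ 0 → u * v ≈ 1 → ¬ u ≈ 0
  unit-nonzero {u} {v} 1≉0 uv≈1 u≈0 = 1≉0 (begin
    1      ≈⟨ uv≈1 ⟨
    u * v  ≈⟨ *-cong u≈0 (≈-refl {v}) ⟩
    0      ∎)

  _≈±_ : ℕ → ℕ → Set
  a ≈± b = a ≈ b ⊎ a + b ≈ 0

  ≈±-refl : ∀ {a} → a ≈± a
  ≈±-refl = inj₁ refl

  ≈±-sym : ∀ {a b} → a ≈± b → b ≈± a
  ≈±-sym (inj₁ a≈b) = inj₁ (≈-sym a≈b)
  ≈±-sym {a} {b} (inj₂ a+b≈0) = inj₂ (≈-trans (≡⇒≈ (+-comm b a)) a+b≈0)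

  ≈±-trans : ∀ {a b c} → a ≈± b → b ≈± c → a ≈± c
  ≈±-trans (inj₁ a≈b) (inj₁ b≈c) = inj₁ (≈-trans a≈b b≈c)
  ≈±-trans {c = c} (inj₁ a≈b) (inj₂ b+c≈0) = inj₂ (≈-trans (+-cong a≈b (≈-refl {c})) b+c≈0)
  ≈±-trans {a} (inj₂ a+b≈0) (inj₁ b≈c) = inj₂ (≈-trans (+-cong (≈-refl {a}) (≈-sym b≈c)) a+b≈0)
  ≈±-trans {a} {b} {c} (inj₂ a+b≈0) (inj₂ b+c≈0) =
    inj₁ (+-cancelʳ b (≈-trans a+b≈0 (≈-sym (≈-trans (≡⇒≈ (+-comm c b)) b+c≈0))))

  ≈±-setoid : Setoid 0ℓ 0ℓ
  ≈±-setoid = record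
    { Carrier = ℕ
    ; _≈_ = _≈±_
    ; isEquivalence = record { refl = ≈±-refl ; sym = ≈±-sym ; trans = ≈±-trans }
    }

  module ≈±-Reasoning = SetoidReasoning ≈±-setoid

  *-absorbs-0 : ∀ {a b} c → a + b ≈ 0 → c * a + c * b ≈ 0
  *-absorbs-0 {a} {b} c a+b≈0 = begin
    c * a + c * b  ≡⟨ *-distribˡ-+ c a b ⟨
    c * (a + b)    ≈⟨ *-cong (≈-refl {c}) a+b≈0 ⟩
    c * 0          ≡⟨ *-zeroʳ c ⟩
    0              ∎

  ≈±-*-congˡ : ∀ c {a b} → a ≈± b → c * a ≈± c * b
  ≈±-*-congˡ c (inj₁ a≈b) = inj₁ (*-cong (≈-refl {c}) a≈b)
  ≈±-*-congˡ c (inj₂ a+b≈0) = inj₂ (*-absorbs-0 c a+b≈0)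

  ≈±-*-cong : ∀ {a b c d} → a ≈± b → c ≈± d → a * c ≈± b * d
  ≈±-*-cong {a} {b} {c} a≈±b c≈±d =
    ≈±-trans (subst₂ _≈±_ (*-comm c a) (*-comm c b) (≈±-*-congˡ c a≈±b)) (≈±-*-congˡ b c≈±d)

  ≈±-^ : ∀ {a b} → a ≈± b → ∀ k → a ^ k ≈± b ^ k
  ≈±-^ a≈±b zero = ≈±-refl
  ≈±-^ a≈±b (suc k) = ≈±-*-cong a≈±b (≈±-^ a≈±b k)

  ≈±-nonzero : ∀ {a b} → a ≈± b → ¬ a ≈ 0 → ¬ b ≈ 0
  ≈±-nonzero (inj₁ a≈b) a≉0 b≈0 = a≉0 (≈-trans a≈b b≈0)
  ≈±-nonzero {a} (inj₂ a+b≈0) a≉0 b≈0 =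
    a≉0 (≈-trans (≡⇒≈ (sym (+-identityʳ a))) (≈-trans (+-cong (≈-refl {a}) (≈-sym b≈0)) a+b≈0))

  ≈±-*-cancelˡ : ∀ {u v a b} → u * v ≈ 1 → u * a ≈± u * b → a ≈± b
  ≈±-*-cancelˡ {u} {v} uv≈1 (inj₁ ua≈ub) = inj₁ (*-cancelˡ {u} {v} uv≈1 ua≈ub)
  ≈±-*-cancelˡ {u} {v} {a} {b} uv≈1 (inj₂ ua+ub≈0) = inj₂ (*-cancelˡ {u} {v} uv≈1 (begin
    u * (a + b)    ≡⟨ *-distribˡ-+ u a b ⟩
    u * a + u * b  ≈⟨ ua+ub≈0 ⟩
    0              ≡⟨ *-zeroʳ u ⟨
    u * 0          ∎))

  ≈±-respʳ : ∀ {a b c} → b ≈± c → a ≈± b ⇔ a ≈± c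
  ≈±-respʳ b≈±c = mk⇔ (λ a≈±b → ≈±-trans a≈±b b≈±c) (λ a≈±c → ≈±-trans a≈±c (≈±-sym b≈±c))

  ≈±-unit⇔ : ∀ {u v a b} → u * v ≈ 1 → a ≈± u * b ⇔ v * a ≈± b
  ≈±-unit⇔ {u} {v} {a} {b} uv≈1 = mk⇔
    (λ a≈±ub → ≈±-trans (≈±-*-congˡ v a≈±ub) (inj₁ (*-inverse-cancelʳ {u} {v} uv≈1 b)))
    (λ va≈±b → ≈±-trans (inj₁ (≈-sym (*-inverse-cancelˡ {u} {v} uv≈1 a))) (≈±-*-congˡ u va≈±b))

  ≈0-unit⇔ : ∀ {u v a} → u * v ≈ 1 → a ≈ 0 ⇔ v * a ≈ 0
  ≈0-unit⇔ {u} {v} {a} uv≈1 = mk⇔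
    (λ a≈0 → ≈-trans (*-cong (≈-refl {v}) a≈0) (≡⇒≈ (*-zeroʳ v)))
    (λ va≈0 → ≈-trans (≈-sym (*-inverse-cancelˡ {u} {v} uv≈1 a))
                (≈-trans (*-cong (≈-refl {u}) va≈0) (≡⇒≈ (*-zeroʳ u))))

  ≡%⇔≈ : ∀ {z} a → z < n → z ≡ a % n ⇔ z ≈ a
  ≡%⇔≈ a z<n = mk⇔ (λ z≡a → trans (cong (_% n) z≡a) (%-≈ a))
                   (λ z≈a → trans (sym (m<n⇒m%n≡m z<n)) z≈a)

  ≡negₙ⇔ : ∀ {z} a → z < n → z ≡ negₙ n a ⇔ z + a ≈ 0
  ≡negₙ⇔ {z} a z<n = mk⇔
    (λ z≡-a → ≈-trans (+-cong (≡⇒≈ z≡-a) (≈-refl {a})) (+-inverseˡ a))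
    (λ z+a≈0 → trans (sym (m<n⇒m%n≡m z<n))
      (trans (+-cancelʳ a (≈-trans z+a≈0 (≈-sym (+-inverseˡ a)))) (%-≈ (n ∸ a % n))))

  ∈±⇔ : ∀ {z a b} → z < n → z ∈±[ a , b ]mod n ⇔ (z ≈± a ⊎ z ≈± b)
  ∈±⇔ z<n = (≡%⇔≈ _ z<n ⊎-⇔ ≡negₙ⇔ _ z<n) ⊎-⇔ (≡%⇔≈ _ z<n ⊎-⇔ ≡negₙ⇔ _ z<n)

  avoids⇔ : ∀ {z} a → z < n →
            (¬ z ≡ 0 × ¬ z ≡ a % n × ¬ z ≡ negₙ n a) ⇔ (¬ z ≈ 0 × ¬ z ≈± a)
  avoids⇔ a z<n = mk⇔
    (λ (z≢0 , z≢a , z≢-a) →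
       z≢0 ∘ ≈0⇒≡0 z<n , [ z≢a ∘ from (≡%⇔≈ a z<n) , z≢-a ∘ from (≡negₙ⇔ a z<n) ]′)
    (λ (z≉0 , z≉±a) →
       z≉0 ∘ cong (_% n) , z≉±a ∘ inj₁ ∘ to (≡%⇔≈ a z<n) , z≉±a ∘ inj₂ ∘ to (≡negₙ⇔ a z<n))

any-applyUpTo⇔ : ∀ {A : Set} {Q : A → Set} {R : ℕ → Set} (f : ℕ → A) N →
                 (∀ i → Q (f i) ⇔ R i) → Any Q (applyUpTo f N) ⇔ (∃ λ i → i < N × R i)
any-applyUpTo⇔ f N Q⇔R = mk⇔
  (λ any → let i , i<N , q = Any.applyUpTo⁻ f any in i , i<N , to (Q⇔R i) q)
  (λ (i , i<N , r) → Any.applyUpTo⁺ f (from (Q⇔R i) r) i<N)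

halve : ∀ r → ∃ λ i → r ≡ i * 2 ⊎ r ≡ 1 + i * 2
halve zero = 0 , inj₁ refl
halve (suc r) with halve r
... | i , inj₁ r≡2i = i , inj₂ (cong suc r≡2i)
... | i , inj₂ r≡1+2i = suc i , inj₁ (cong suc r≡1+2i)

∃-odd-even⇔ : ∀ {P : ℕ → Set} N →
              (∃ λ j → 0 < j × j < 1 + N * 2 × P j) ⇔
              (∃ λ i → i < N × (P (1 + i * 2) ⊎ P (2 + i * 2)))
∃-odd-even⇔ {P} N = mk⇔ split join
  where
  split : (∃ λ j → 0 < j × j < 1 + N * 2 × P j) → ∃ λ i → i < N × (P (1 + i * 2) ⊎ P (2 + i * 2))
  split (suc r , _ , s<s r<2N , Pj) with halve r
  ... | i , inj₁ refl = i , *-cancelʳ-< 2 i N r<2N , inj₁ Pj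
  ... | i , inj₂ refl = i , *-cancelʳ-< 2 i N (<-trans (n<1+n (i * 2)) r<2N) , inj₂ Pj
  join : (∃ λ i → i < N × (P (1 + i * 2) ⊎ P (2 + i * 2))) → ∃ λ j → 0 < j × j < 1 + N * 2 × P j
  join (i , i<N , inj₁ P₁) = 1 + i * 2 , z<s , s<s (*-monoˡ-< 2 i<N) , P₁
  join (i , i<N , inj₂ P₂) = 2 + i * 2 , z<s , s<s (*-monoˡ-≤ 2 i<N) , P₂

module RepresentativesModSign (n m : ℕ) .{{_ : NonZero n}} (n≡1+2m : n ≡ suc (m + m)) where

  open Congruence n

  ≤2m⇒<n : ∀ {a} → a ≤ m + m → a < n
  ≤2m⇒<n {a} a≤2m = subst (a <_) (sym n≡1+2m) (s≤s a≤2m)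

  class : Fin m → ℕ
  class i = suc (toℕ i)

  class<n : ∀ i → class i < n
  class<n i = ≤2m⇒<n (≤-trans (toℕ<n i) (m≤m+n m m))

  class-nonzero : ∀ i → ¬ class i ≈ 0
  class-nonzero i cᵢ≈0 with ≈0⇒≡0 (class<n i) cᵢ≈0
  ... | ()

  class-injective : ∀ {i j} → class i ≈± class j → i ≡ j
  class-injective {i} {j} (inj₁ cᵢ≈cⱼ) =
    toℕ-injective (suc-injective (≈⇒≡ (class<n i) (class<n j) cᵢ≈cⱼ))
  class-injective {i} {j} (inj₂ cᵢ+cⱼ≈0)
    with ≈0⇒≡0 (≤2m⇒<n (+-mono-≤ (toℕ<n i) (toℕ<n j))) cᵢ+cⱼ≈0
  ... | ()

  canonical-representative : ∀ a → a < n → ¬ a ≡ 0 → ∃ λ i → a ≈± class i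
  canonical-representative zero _ a≢0 = ⊥-elim (a≢0 refl)
  canonical-representative (suc b) 1+b<n _ with b <? m
  ... | yes b<m = fromℕ< b<m , inj₁ (cong (λ x → suc x % n) (sym (toℕ-fromℕ< b<m)))
  ... | no b≮m = fromℕ< c<m , inj₂ (≈-trans (≡⇒≈ 1+b+1+c≡n) n≈0)
    where
    c : ℕ
    c = m + m ∸ suc b
    1+b+c≡2m : suc b + c ≡ m + m
    1+b+c≡2m = m+[n∸m]≡n (≤-pred (subst (suc b <_) n≡1+2m 1+b<n))
    c<m : c < m
    c<m = +-cancelˡ-< m c m
      (≤-<-trans (+-monoˡ-≤ c (≮⇒≥ b≮m)) (subst (b + c <_) 1+b+c≡2m (n<1+n (b + c))))
    1+b+1+c≡n : suc b + class (fromℕ< c<m) ≡ n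
    1+b+1+c≡n = begin
      suc b + suc (toℕ (fromℕ< c<m))  ≡⟨ cong (λ x → suc b + suc x) (toℕ-fromℕ< c<m) ⟩
      suc b + suc c                   ≡⟨ +-suc (suc b) c ⟩
      suc (suc b + c)                 ≡⟨ cong suc 1+b+c≡2m ⟩
      suc (m + m)                     ≡⟨ n≡1+2m ⟨
      n                               ∎
      where open ≡-Reasoning

  representative : ∀ w → ¬ w ≈ 0 → ∃ λ i → w ≈± class i
  representative w w≉0 =
    let i , w%n≈±cᵢ = canonical-representative (w % n) (m%n<n w n) (w≉0 ∘ w%n≡0⇒w≈0)
    in i , ≈±-trans (inj₁ (≈-sym (%-≈ w))) w%n≈±cᵢ
    where
    w%n≡0⇒w≈0 : w % n ≡ 0 → w ≈ 0
    w%n≡0⇒w≈0 w%n≡0 = trans w%n≡0 (sym 0%n≡0)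

module PowersModSign (n m : ℕ) .{{_ : NonZero n}} .{{_ : NonZero m}} (n≡1+2m : n ≡ suc (m + m))
                     (θ θ⁻¹ : ℕ) (θθ⁻¹≈1 : (θ * θ⁻¹) % n ≡ 1 % n)
                     (θ-generates : GeneratesModSign n θ) where

  open Congruence n
  open RepresentativesModSign n m n≡1+2m

  1<n : 1 < n
  1<n = ≤2m⇒<n (≤-trans (>-nonZero⁻¹ m) (m≤m+n m m))

  power-nonzero : ∀ k → ¬ θ ^ k ≈ 0
  power-nonzero k = unit-nonzero {θ ^ k} {θ⁻¹ ^ k} (1≉0 1<n) (^-inverse {θ} {θ⁻¹} θθ⁻¹≈1 k)

  power-cancelˡ : ∀ k {a b} → θ ^ k * a ≈± θ ^ k * b → a ≈± b
  power-cancelˡ k = ≈±-*-cancelˡ {θ ^ k} {θ⁻¹ ^ k} (^-inverse {θ} {θ⁻¹} θθ⁻¹≈1 k)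

  generates : ∀ w → ¬ w ≈ 0 → ∃ λ k → θ ^ k ≈± w
  generates w w≉0 with θ-generates w (λ w%n≡0 → w≉0 (trans w%n≡0 (sym 0%n≡0)))
  ... | k , inj₁ θᵏ≈w = k , inj₁ θᵏ≈w
  ... | k , inj₂ θᵏ≡-w =
    k , inj₂ (≈-trans (+-cong (≈-sym (%-≈ (θ ^ k))) (≈-refl {w})) (to (≡negₙ⇔ w (m%n<n _ n)) θᵏ≡-w))

  exponent-mod : ∀ d .{{_ : NonZero d}} → θ ^ d ≈± 1 → ∀ k → θ ^ k ≈± θ ^ (k % d)
  exponent-mod d θᵈ≈±1 k = begin
    θ ^ k                            ≡⟨ cong (θ ^_) (m≡m%n+[m/n]*n k d) ⟩
    θ ^ (k % d + k / d * d)          ≡⟨ ^-distribˡ-+-* θ (k % d) (k / d * d) ⟩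
    θ ^ (k % d) * θ ^ (k / d * d)    ≡⟨ cong (λ e → θ ^ (k % d) * θ ^ e) (*-comm (k / d) d) ⟩
    θ ^ (k % d) * θ ^ (d * (k / d))  ≡⟨ cong (θ ^ (k % d) *_) (^-*-assoc θ d (k / d)) ⟨
    θ ^ (k % d) * (θ ^ d) ^ (k / d)  ≈⟨ ≈±-*-congˡ (θ ^ (k % d)) (≈±-^ θᵈ≈±1 (k / d)) ⟩
    θ ^ (k % d) * 1 ^ (k / d)        ≡⟨ cong (θ ^ (k % d) *_) (^-zeroˡ (k / d)) ⟩
    θ ^ (k % d) * 1                  ≡⟨ *-identityʳ (θ ^ (k % d)) ⟩
    θ ^ (k % d)                      ∎
    where open ≈±-Reasoning

  power-gap : ∀ {a b} → a ≤ b → θ ^ a ≈± θ ^ b → θ ^ (b ∸ a) ≈± 1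
  power-gap {a} {b} a≤b θᵃ≈±θᵇ = ≈±-sym (power-cancelˡ a (begin
    θ ^ a * 1            ≡⟨ *-identityʳ (θ ^ a) ⟩
    θ ^ a                ≈⟨ θᵃ≈±θᵇ ⟩
    θ ^ b                ≡⟨ cong (θ ^_) (m+[n∸m]≡n a≤b) ⟨
    θ ^ (a + (b ∸ a))    ≡⟨ ^-distribˡ-+-* θ a (b ∸ a) ⟩
    θ ^ a * θ ^ (b ∸ a)  ∎))
    where open ≈±-Reasoning

  -- There are only m classes of nonzero residues up to sign, so a shorter period d
  -- would force two of them to be the same power θ ^ (k % d).
  order : ∀ d → 0 < d → d < m → ¬ θ ^ d ≈± 1
  order d 0<d d<m θᵈ≈±1 =
    let i , j , i<j , rᵢ≡rⱼ = pigeonhole d<m reduced-exponent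
    in <⇒≢ i<j (cong toℕ (class-injective (begin
      class i                         ≈⟨ class≈±power i ⟩
      θ ^ toℕ (reduced-exponent i)    ≡⟨ cong (λ r → θ ^ toℕ r) rᵢ≡rⱼ ⟩
      θ ^ toℕ (reduced-exponent j)    ≈⟨ class≈±power j ⟨
      class j                         ∎)))
    where
    open ≈±-Reasoning
    instance
      d≢0 : NonZero d
      d≢0 = >-nonZero 0<d
    exponent : Fin m → ℕ
    exponent i = proj₁ (generates (class i) (class-nonzero i))
    reduced-exponent : Fin m → Fin d
    reduced-exponent i = fromℕ< (m%n<n (exponent i) d)
    class≈±power : ∀ i → class i ≈± θ ^ toℕ (reduced-exponent i)
    class≈±power i rewrite toℕ-fromℕ< (m%n<n (exponent i) d) =
      ≈±-trans (≈±-sym (proj₂ (generates (class i) (class-nonzero i))))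
               (exponent-mod d θᵈ≈±1 (exponent i))

  -- Among θ ^ 0, …, θ ^ m two powers fall into the same of the m classes.
  short-period : ∃ λ d → 0 < d × d ≤ m × θ ^ d ≈± 1
  short-period = from-collision (pigeonhole (n<1+n m) class-of-power)
    where
    class-of-power : Fin (suc m) → Fin m
    class-of-power a = proj₁ (representative (θ ^ toℕ a) (power-nonzero (toℕ a)))
    power≈±class : ∀ a → θ ^ toℕ a ≈± class (class-of-power a)
    power≈±class a = proj₂ (representative (θ ^ toℕ a) (power-nonzero (toℕ a)))
    same-class⇒≈± : ∀ {a b} → class-of-power a ≡ class-of-power b → θ ^ toℕ a ≈± θ ^ toℕ b
    same-class⇒≈± {a} {b} same-class =
      ≈±-trans (power≈±class a)
        (subst (λ c → class c ≈± θ ^ toℕ b) (sym same-class) (≈±-sym (power≈±class b)))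
    from-collision : (∃₂ λ a b → a Fin.< b × class-of-power a ≡ class-of-power b) →
                     ∃ λ d → 0 < d × d ≤ m × θ ^ d ≈± 1
    from-collision (a , b , a<b , same-class) =
      toℕ b ∸ toℕ a , m<n⇒0<n∸m a<b , ≤-trans (m∸n≤m (toℕ b) (toℕ a)) (≤-pred (toℕ<n b)) ,
      power-gap (<⇒≤ a<b) (same-class⇒≈± {a} {b} same-class)

  period : θ ^ m ≈± 1
  period = full-period short-period
    where
    full-period : (∃ λ d → 0 < d × d ≤ m × θ ^ d ≈± 1) → θ ^ m ≈± 1
    full-period (d , 0<d , d≤m , θᵈ≈±1) =
      [ (λ d<m → ⊥-elim (order d 0<d d<m θᵈ≈±1)) , (λ d≡m → subst (λ e → θ ^ e ≈± 1) d≡m θᵈ≈±1) ]′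
      (m≤n⇒m<n∨m≡n d≤m)

  power-below-m : ∀ w → ¬ w ≈ 0 → ∃ λ j → j < m × θ ^ j ≈± w
  power-below-m w w≉0 = reduce (generates w w≉0)
    where
    reduce : (∃ λ k → θ ^ k ≈± w) → ∃ λ j → j < m × θ ^ j ≈± w
    reduce (k , θᵏ≈±w) = k % m , m%n<n k m , ≈±-trans (≈±-sym (exponent-mod m period k)) θᵏ≈±w

  nontrivial⇔power : ∀ w → (¬ w ≈ 0 × ¬ w ≈± 1) ⇔ (∃ λ j → 0 < j × j < m × w ≈± θ ^ j)
  nontrivial⇔power w = mk⇔ toPower fromPower
    where
    toPower : ¬ w ≈ 0 × ¬ w ≈± 1 → ∃ λ j → 0 < j × j < m × w ≈± θ ^ j
    toPower (w≉0 , w≉±1) = positive (power-below-m w w≉0)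
      where
      positive : (∃ λ j → j < m × θ ^ j ≈± w) → ∃ λ j → 0 < j × j < m × w ≈± θ ^ j
      positive (zero , _ , 1≈±w) = ⊥-elim (w≉±1 (≈±-sym 1≈±w))
      positive (suc j , j<m , θʲ≈±w) = suc j , z<s , j<m , ≈±-sym θʲ≈±w
    fromPower : (∃ λ j → 0 < j × j < m × w ≈± θ ^ j) → ¬ w ≈ 0 × ¬ w ≈± 1
    fromPower (j , 0<j , j<m , w≈±θʲ) =
      ≈±-nonzero (≈±-sym w≈±θʲ) (power-nonzero j) ,
      λ w≈±1 → order j 0<j j<m (≈±-trans (≈±-sym w≈±θʲ) w≈±1)

module APSFromSquareRootOfTwo (n N : ℕ) .{{_ : NonZero n}} (n≡3+4N : n ≡ 3 + N * 4)
                              (s : ℕ) (s²≈2 : (s * s) % n ≡ 2 % n)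
                              (θ-generates : GeneratesModSign n (1 + s)) where

  open Congruence n

  m : ℕ
  m = 1 + N * 2

  n≡1+2m : n ≡ suc (m + m)
  n≡1+2m = trans n≡3+4N (identity N)
    where
    identity : ∀ N → 3 + N * 4 ≡ suc ((1 + N * 2) + (1 + N * 2))
    identity = solve-∀

  θ : ℕ
  θ = 1 + s

  θ⁻¹ : ℕ
  θ⁻¹ = s + (m + m)

  -- (1 + s)(s - 1) = s² - 1 = 1, with s - 1 represented by s + (n - 1).
  θθ⁻¹≈1 : θ * θ⁻¹ ≈ 1
  θθ⁻¹≈1 = begin
    θ * θ⁻¹                                 ≡⟨ expand s m ⟩
    s * s + (s + (m + m) + s * (m + m))     ≈⟨ +-cong s²≈2 (≈-refl {s + (m + m) + s * (m + m)}) ⟩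
    2 + (s + (m + m) + s * (m + m))         ≡⟨ collect s m ⟩
    1 + θ * suc (m + m)                     ≡⟨ cong (λ k → 1 + θ * k) n≡1+2m ⟨
    1 + θ * n                               ≈⟨ [m+kn]%n≡m%n 1 θ n ⟩
    1                                       ∎
    where
    open ≈-Reasoning
    expand : ∀ s m → (1 + s) * (s + (m + m)) ≡ s * s + (s + (m + m) + s * (m + m))
    expand = solve-∀
    collect : ∀ s m → 2 + (s + (m + m) + s * (m + m)) ≡ 1 + (1 + s) * suc (m + m)
    collect = solve-∀

  s⁻¹ : ℕ
  s⁻¹ = s * suc m

  -- s² (m + 1) = 2 (m + 1) = n + 1.
  ss⁻¹≈1 : s * s⁻¹ ≈ 1
  ss⁻¹≈1 = begin
    s * (s * suc m)      ≡⟨ *-assoc s s (suc m) ⟨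
    s * s * suc m        ≈⟨ *-cong s²≈2 (≈-refl {suc m}) ⟩
    2 * suc m            ≡⟨ double m ⟩
    1 + 1 * suc (m + m)  ≡⟨ cong (λ k → 1 + 1 * k) n≡1+2m ⟨
    1 + 1 * n            ≈⟨ [m+kn]%n≡m%n 1 1 n ⟩
    1                    ∎
    where
    open ≈-Reasoning
    double : ∀ m → 2 * suc m ≡ 1 + 1 * suc (m + m)
    double = solve-∀

  open PowersModSign n m n≡1+2m θ θ⁻¹ θθ⁻¹≈1 θ-generates

  difference-≈± : ∀ x → subₙ n (x % n) (θ * x % n) ≈± s * x
  difference-≈± x = inj₂ (+-cancelʳ (θ * x % n) (begin
    d + s * x + y        ≡⟨ +-right-comm d (s * x) y ⟩
    d + y + s * x        ≈⟨ +-cong (subₙ-+ (x % n) y) (≈-refl {s * x}) ⟩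
    x % n + s * x        ≈⟨ +-cong (%-≈ x) (≈-refl {s * x}) ⟩
    θ * x                ≈⟨ %-≈ (θ * x) ⟨
    0 + y                ∎))
    where
    open ≈-Reasoning
    y = θ * x % n
    d = subₙ n (x % n) y

  sum-≈± : ∀ x → addₙ n (x % n) (θ * x % n) ≈± s * (θ * x)
  sum-≈± x = inj₁ (begin
    addₙ n (x % n) (θ * x % n)  ≈⟨ %-≈ (x % n + θ * x % n) ⟩
    x % n + θ * x % n           ≈⟨ +-cong (%-≈ x) (%-≈ (θ * x)) ⟩
    x + θ * x                   ≡⟨ expand s x ⟩
    2 * x + s * x               ≈⟨ +-cong (*-cong (≈-sym s²≈2) (≈-refl {x})) (≈-refl {s * x}) ⟩
    s * s * x + s * x           ≡⟨ collect s x ⟩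
    s * (θ * x)                 ∎)
    where
    open ≈-Reasoning
    expand : ∀ s x → x + (1 + s) * x ≡ 2 * x + s * x
    expand = solve-∀
    collect : ∀ s x → s * s * x + s * x ≡ s * ((1 + s) * x)
    collect = solve-∀

  β : ℕ
  β = subₙ n (1 + s) 1

  β≈s : β ≈ s
  β≈s = +-cancelʳ 1 (≈-trans (subₙ-+ (1 + s) 1) (≡⇒≈ (+-comm 1 s)))

  pair : ℕ → ℕ × ℕ
  pair i = θ ^ (1 + i * 2) % n , θ ^ (2 + i * 2) % n

  pairs : List (ℕ × ℕ)
  pairs = applyUpTo pair N

  odd-even-power⇔nontrivial : ∀ w →
    (∃ λ i → i < N × (w ≈± θ ^ (1 + i * 2) ⊎ w ≈± θ ^ (2 + i * 2))) ⇔ (¬ w ≈ 0 × ¬ w ≈± 1)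
  odd-even-power⇔nontrivial w = ⇔-trans (⇔-sym (∃-odd-even⇔ N)) (⇔-sym (nontrivial⇔power w))

  cover₁ : ∀ z → z < n →
    Any (λ xy → z ∈±[ proj₁ xy , proj₂ xy ]mod n) pairs ⇔
    (¬ z ≡ 0 × ¬ z ≡ 1 % n × ¬ z ≡ negₙ n 1)
  cover₁ z z<n =
    ⇔-trans (any-applyUpTo⇔ pair N λ i → ⇔-trans (∈±⇔ z<n) (drop-% ⊎-⇔ drop-%))
    (⇔-trans (odd-even-power⇔nontrivial z) (⇔-sym (avoids⇔ 1 z<n)))
    where
    drop-% : ∀ {a} → z ≈± a % n ⇔ z ≈± a
    drop-% {a} = ≈±-respʳ (inj₁ (%-≈ a))

  cover₂ : ∀ z → z < n →
    Any (λ xy → z ∈±[ subₙ n (proj₁ xy) (proj₂ xy) , addₙ n (proj₁ xy) (proj₂ xy) ]mod n) pairs ⇔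
    (¬ z ≡ 0 × ¬ z ≡ β % n × ¬ z ≡ negₙ n β)
  cover₂ z z<n =
    ⇔-trans (any-applyUpTo⇔ pair N λ i →
               ⇔-trans (∈±⇔ z<n) (unscale (difference-≈± _) ⊎-⇔ unscale (sum-≈± _)))
    (⇔-trans (odd-even-power⇔nontrivial (s⁻¹ * z))
    (⇔-trans (¬-cong-⇔ (⇔-sym (≈0-unit⇔ {s} {s⁻¹} ss⁻¹≈1)) ×-⇔ ¬-cong-⇔ (⇔-sym (unscale β≈±s*1)))
             (⇔-sym (avoids⇔ β z<n))))
    where
    unscale : ∀ {a x} → a ≈± s * x → z ≈± a ⇔ s⁻¹ * z ≈± x
    unscale a≈±sx = ⇔-trans (≈±-respʳ a≈±sx) (≈±-unit⇔ {s} {s⁻¹} ss⁻¹≈1)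
    β≈±s*1 : β ≈± s * 1
    β≈±s*1 = inj₁ (≈-trans β≈s (≡⇒≈ (sym (*-identityʳ s))))

  2<n : 2 < n
  2<n = subst (2 <_) (sym n≡3+4N) (s≤s (s≤s (s≤s z≤n)))

  s≉0 : ¬ s ≈ 0
  s≉0 s≈0 with ≈0⇒≡0 2<n (≈-trans (≈-sym s²≈2) (*-cong s≈0 (≈-refl {s})))
  ... | ()

  aps : APS n 1 β
  aps = record
    { n≡3mod4 = trans (cong (_% 4) n≡3+4N) ([m+kn]%n≡m%n 3 N 4)
    ; α≢0     = λ 1%n≡0 → 1≉0 1<n (trans 1%n≡0 (sym 0%n≡0))
    ; β≢0     = λ β%n≡0 → s≉0 (≈-trans (≈-sym β≈s) (trans β%n≡0 (sym 0%n≡0)))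
    ; pairs   = pairs
    ; inRange = All.applyUpTo⁺₂ pair N (λ i → m%n<n _ n , m%n<n _ n)
    ; size    = trans (length-applyUpTo pair N)
                  (sym (trans (cong (λ k → (k ∸ 3) / 4) n≡3+4N) (m*n/n≡m N 4)))
    ; cover₁  = cover₁
    ; cover₂  = cover₂
    }

lemma4p4 : (p : ℕ) .{{_ : NonZero p}} → Prime p → p % 8 ≡ 7 →
    (s : ℕ) → s < p → (s * s) % p ≡ 2 % p →
    GeneratesModSign p (1 + s) →
    APS p 1 (subₙ p (1 + s) 1)
lemma4p4 p _ p%8≡7 s _ s²≈2 θ-generates = aps
  where
  N : ℕ
  N = 1 + p / 8 * 2
  p≡3+4N : p ≡ 3 + N * 4
  p≡3+4N = trans (m≡m%n+[m/n]*n p 8) (trans (cong (_+ p / 8 * 8) p%8≡7) (regroup (p / 8)))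
    where
    regroup : ∀ q → 7 + q * 8 ≡ 3 + (1 + q * 2) * 4
    regroup = solve-∀
  open APSFromSquareRootOfTwo p N p≡3+4N s s²≈2 θ-generates
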